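{- Let $d\ge 2$ be an integer and $a\in\mathbb{Q}^*$. For $b\in\{1,-1\}$ let $\psi_{d,a,b}(z)=\frac{z}{az^d+b}$, viewed as a map $\mathbb{P}^1\to\mathbb{P}^1$. Then: (a) $\psi_{d,a,1}$ has no fixed point other than $z=0$. (b) $\psi_{d,a,-1}$ has at most two rational fixed points (including $z=0$) if $d$ is odd, and at most three rational fixed points (including $z=0$) if $d$ is even. (c) Every rational periodic cycle of $\psi_{d,a,1}$ has length $1$ or $2$; a rational periodic cycle of length $2$ exists only if $d$ is even, and in that case there is at most one such cycle. (d) $\psi_{d,a,-1}$ has no rational periodic cycle of length at least $2$.
   Context: In homogeneous coordinates $\psi_{d,a,b}([X,Y]) = [XY^{d-1}, aX^d+bY^d]$. A rational fixed point is a point of $\mathbb{P}^1(\mathbb{Q})$ fixed by the map. A rational periodic cycle of length $n$ is a set of $n$ distinct points $z_1,\dots,z_n\in\mathbb{P}^1(\mathbb{Q})$ with $\psi(z_i)=z_{i+1}$ for $i<n$ and $\psi(z_n)=z_1$. -}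

module Defs where

open import Data.Nat using (ℕ; zero; suc; _∸_)
open import Data.Rational using (ℚ; 0ℚ; 1ℚ; _*_; _+_)
open import Data.Fin using (Fin; inject₁; fromℕ)
import Data.Fin as F
open import Data.Product using (_×_; _,_; proj₁; proj₂)
open import Relation.Binary.PropositionalEquality using (_≡_)
open import Relation.Nullary using (¬_)

infixr 8 _^_
_^_ : ℚ → ℕ → ℚ
q ^ zero  = 1ℚ
q ^ suc n = q * (q ^ n)

-- homogeneous coordinates [X , Y] of a point of P¹(ℚ)
Pt : Set
Pt = ℚ × ℚ

Valid : Pt → Set
Valid (X , Y) = ¬ (X ≡ 0ℚ × Y ≡ 0ℚ)

infix 4 _≈P_
_≈P_ : Pt → Pt → Set
(X , Y) ≈P (X' , Y') = X * Y' ≡ X' * Y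

zeroPt : Pt
zeroPt = (0ℚ , 1ℚ)

ψ : ℕ → ℚ → ℚ → Pt → Pt
ψ d a b (X , Y) = (X * Y ^ (d ∸ 1) , a * X ^ d + b * Y ^ d)

IsFixed : ℕ → ℚ → ℚ → Pt → Set
IsFixed d a b z = Valid z × ψ d a b z ≈P z

-- a rational periodic cycle of length n = suc m: points z₀,…,z_m of P¹(ℚ),
-- pairwise distinct, with ψ(z_i) = z_{i+1} for i < m and ψ(z_m) = z₀
record IsCycle (d : ℕ) (a b : ℚ) (m : ℕ) (z : Fin (suc m) → Pt) : Set where
  field
    valid    : ∀ i → Valid (z i)
    distinct : ∀ i j → z i ≈P z j → i ≡ j
    step     : ∀ (i : Fin m) → ψ d a b (z (inject₁ i)) ≈P z (F.suc i)
    wrap     : ψ d a b (z (fromℕ m)) ≈P z F.zero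

-- Write u = a z^d for the affine coordinate z = X / Y, so that ψ(z) = z / (b + u).
-- A fixed point z ≠ 0, ∞ has a z^d = 1 - b: there is none for b = 1, and two of them
-- differ by a d-th root of unity in ℚ, i.e. by a sign, which is trivial for odd d.
-- Along an orbit u ↦ u' = u / (b + u)^d.  For b = ±1 and u = ν/μ in lowest terms,
-- u' = ν μ^(d-1) / (bμ + ν)^d is again in lowest terms, so |ν| never decreases; around a
-- cycle it is therefore constant, which forces μ = 1 at every point and then b + u = ±1.
-- On a cycle of length ≥ 2 the sign +1 is excluded, so every step is z ↦ -z with
-- u = -1 - b: for b = -1 this says u = 0, which is impossible, and for b = 1 the cycle is
-- {z, -z} with a z^d = -2, which closes up only for even d and is unique.

module Submission where

open import Defs
open import Data.Nat.Base as ℕ using (ℕ; zero; suc; _≤_; z≤n; s≤s)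
import Data.Nat.Properties as ℕ
open import Data.Nat.Coprimality as Coprimality using (Coprime)
open import Data.Nat.Divisibility as ℕ∣ using (_∣_; divides)
open import Data.Integer.Base as ℤ using (ℤ)
import Data.Integer.Properties as ℤ
import Data.Integer.Divisibility.Signed as ℤ∣
open import Data.Rational.Base
  using (ℚ; mkℚ; 0ℚ; 1ℚ; -_; _+_; _*_; _-_; _/_; 1/_; _÷_; NonZero; ↥_; ↧_; ↧ₙ_; ∣_∣; toℚᵘ; ≢-nonZero; nonNegative; positive)
import Data.Rational.Base as ℚ
open import Data.Rational.Properties
import Data.Rational.Unnormalised.Base as ℚᵘ
import Data.Rational.Unnormalised.Properties as ℚᵘ
open import Data.Rational.Solver using (module +-*-Solver)
open +-*-Solver
open import Algebra.Properties.Group +-0-group using (x∙y⁻¹≈ε⇒x≈y; ⁻¹-involutive; ∙-cancelˡ)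
open import Data.Fin.Base using (Fin; zero; suc; inject₁; fromℕ; toℕ)
open import Data.Fin.Properties using (toℕ-inject₁)
open import Data.Fin.Induction using (<-weakInduction; >-weakInduction)
open import Data.Product.Base using (_×_; _,_; proj₁; proj₂; ∃-syntax)
open import Data.List.Base using (List; []; _∷_; length)
open import Data.List.Relation.Unary.All using (All; []; _∷_)
open import Data.List.Relation.Unary.AllPairs using (AllPairs; []; _∷_)
open import Data.Sum.Base using (_⊎_; inj₁; inj₂; [_,_]′)
open import Data.Empty using (⊥; ⊥-elim)
open import Relation.Nullary using (¬_; yes; no; contradiction)
open import Relation.Nullary.Decidable using (toSum)
open import Relation.Binary.Definitions using (tri<; tri≈; tri>)
open import Relation.Binary.PropositionalEquality
open import Function.Base using (_∘′_)
open ≡-Reasoning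

p*q≡0⇒p≡0∨q≡0 : ∀ p q → p * q ≡ 0ℚ → p ≡ 0ℚ ⊎ q ≡ 0ℚ
p*q≡0⇒p≡0∨q≡0 p q pq≡0 with p ≟ 0ℚ
... | yes p≡0 = inj₁ p≡0
... | no p≢0 = inj₂ (begin
  q              ≡⟨ *-identityˡ q ⟨
  1ℚ * q         ≡⟨ cong (_* q) (*-inverseˡ p) ⟨
  1/ p * p * q   ≡⟨ *-assoc (1/ p) p q ⟩
  1/ p * (p * q) ≡⟨ cong (1/ p *_) pq≡0 ⟩
  1/ p * 0ℚ      ≡⟨ *-zeroʳ (1/ p) ⟩
  0ℚ             ∎)
  where
  instance
    p-nonZero : NonZero p
    p-nonZero = ≢-nonZero p≢0

*-≢0 : ∀ {p q} → p ≢ 0ℚ → q ≢ 0ℚ → p * q ≢ 0ℚ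
*-≢0 {p} {q} p≢0 q≢0 pq≡0 = [ p≢0 , q≢0 ]′ (p*q≡0⇒p≡0∨q≡0 p q pq≡0)

p*q≡0⇒q≡0 : ∀ p q → p ≢ 0ℚ → p * q ≡ 0ℚ → q ≡ 0ℚ
p*q≡0⇒q≡0 p q p≢0 pq≡0 = [ (λ p≡0 → contradiction p≡0 p≢0) , (λ q≡0 → q≡0) ]′ (p*q≡0⇒p≡0∨q≡0 p q pq≡0)

*-cancelˡ-≢0 : ∀ p {q r} → p ≢ 0ℚ → p * q ≡ p * r → q ≡ r
*-cancelˡ-≢0 p {q} {r} p≢0 pq≡pr = x∙y⁻¹≈ε⇒x≈y q r (p*q≡0⇒q≡0 p (q - r) p≢0 (begin
  p * (q - r)   ≡⟨ solve 3 (λ p q r → p :* (q :- r) := p :* q :- p :* r) refl p q r ⟩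
  p * q - p * r ≡⟨ cong (_- p * r) pq≡pr ⟩
  p * r - p * r ≡⟨ +-inverseʳ (p * r) ⟩
  0ℚ            ∎))

*-cancelʳ-≢0 : ∀ p {q r} → p ≢ 0ℚ → q * p ≡ r * p → q ≡ r
*-cancelʳ-≢0 p {q} {r} p≢0 qp≡rp = *-cancelˡ-≢0 p p≢0 (trans (*-comm p q) (trans qp≡rp (*-comm r p)))

^-distrib-* : ∀ x y n → (x * y) ^ n ≡ x ^ n * y ^ n
^-distrib-* x y zero = refl
^-distrib-* x y (suc n) = begin
  x * y * (x * y) ^ n     ≡⟨ cong (x * y *_) (^-distrib-* x y n) ⟩
  x * y * (x ^ n * y ^ n) ≡⟨ solve 4 (λ x y a b → x :* y :* (a :* b) := x :* a :* (y :* b)) refl x y (x ^ n) (y ^ n) ⟩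
  x * x ^ n * (y * y ^ n) ∎

x^n≡0⇒x≡0 : ∀ x n → x ^ n ≡ 0ℚ → x ≡ 0ℚ
x^n≡0⇒x≡0 x zero 1≡0 = contradiction 1≡0 1≢0
x^n≡0⇒x≡0 x (suc n) xxⁿ≡0 = [ (λ h → h) , x^n≡0⇒x≡0 x n ]′ (p*q≡0⇒p≡0∨q≡0 x (x ^ n) xxⁿ≡0)

^-≢0 : ∀ {x} n → x ≢ 0ℚ → x ^ n ≢ 0ℚ
^-≢0 {x} n x≢0 = x≢0 ∘′ x^n≡0⇒x≡0 x n

-1^[n+2]≡-1^n : ∀ n → (- 1ℚ) ^ suc (suc n) ≡ (- 1ℚ) ^ n
-1^[n+2]≡-1^n n = solve 1 (λ x → (:- con 1ℚ) :* ((:- con 1ℚ) :* x) := x) refl ((- 1ℚ) ^ n)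

-1^n-parity : ∀ n → ((- 1ℚ) ^ n ≡ 1ℚ × 2 ∣ n) ⊎ ((- 1ℚ) ^ n ≡ - 1ℚ × ¬ 2 ∣ n)
-1^n-parity zero = inj₁ (refl , divides 0 refl)
-1^n-parity (suc zero) = inj₂ (refl , λ 2∣1 → contradiction (ℕ∣.∣1⇒≡1 2∣1) λ ())
-1^n-parity (suc (suc n)) =
  [ (λ (-1ⁿ≡1 , 2∣n) → inj₁ (trans (-1^[n+2]≡-1^n n) -1ⁿ≡1 , ℕ∣.∣m∣n⇒∣m+n (ℕ∣.n∣n {2}) 2∣n))
  , (λ (-1ⁿ≡-1 , 2∤n) → inj₂ (trans (-1^[n+2]≡-1^n n) -1ⁿ≡-1 , λ 2∣2+n → 2∤n (ℕ∣.∣m+n∣m⇒∣n 2∣2+n (ℕ∣.n∣n {2})))) ]′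
  (-1^n-parity n)

∣x^n∣≡∣x∣^n : ∀ x n → ∣ x ^ n ∣ ≡ ∣ x ∣ ^ n
∣x^n∣≡∣x∣^n x zero = refl
∣x^n∣≡∣x∣^n x (suc n) = trans (∣p*q∣≡∣p∣*∣q∣ x (x ^ n)) (cong (∣ x ∣ *_) (∣x^n∣≡∣x∣^n x n))

x^n-nonNeg : ∀ {x} n → 0ℚ ℚ.≤ x → 0ℚ ℚ.≤ x ^ n
x^n-nonNeg zero 0≤x = nonNegative⁻¹ 1ℚ
x^n-nonNeg {x} (suc n) 0≤x = nonNegative⁻¹ (x * x ^ n)
  {{nonNeg*nonNeg⇒nonNeg x {{nonNegative 0≤x}} (x ^ n) {{nonNegative (x^n-nonNeg n 0≤x)}}}}

^-monoˡ-< : ∀ {x y} n → 0ℚ ℚ.≤ x → x ℚ.< y → x ^ suc n ℚ.< y ^ suc n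
^-monoˡ-< {x} {y} zero 0≤x x<y = subst₂ ℚ._<_ (sym (*-identityʳ x)) (sym (*-identityʳ y)) x<y
^-monoˡ-< {x} {y} (suc n) 0≤x x<y = ≤-<-trans
  (*-monoˡ-≤-nonNeg x {{nonNegative 0≤x}} (<⇒≤ xⁿ<yⁿ))
  (*-monoˡ-<-pos (y ^ suc n) {{positive (≤-<-trans (x^n-nonNeg (suc n) 0≤x) xⁿ<yⁿ)}} x<y)
  where
  xⁿ<yⁿ : x ^ suc n ℚ.< y ^ suc n
  xⁿ<yⁿ = ^-monoˡ-< n 0≤x x<y

∣p∣≡∣q∣⇒p≡q∨p≡-q : ∀ p q → ∣ p ∣ ≡ ∣ q ∣ → p ≡ q ⊎ p ≡ - q
∣p∣≡∣q∣⇒p≡q∨p≡-q p q ∣p∣≡∣q∣ with ∣p∣≡p∨∣p∣≡-p p | ∣p∣≡p∨∣p∣≡-p q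
... | inj₁ ∣p∣≡p | inj₁ ∣q∣≡q = inj₁ (trans (sym ∣p∣≡p) (trans ∣p∣≡∣q∣ ∣q∣≡q))
... | inj₁ ∣p∣≡p | inj₂ ∣q∣≡-q = inj₂ (trans (sym ∣p∣≡p) (trans ∣p∣≡∣q∣ ∣q∣≡-q))
... | inj₂ ∣p∣≡-p | inj₁ ∣q∣≡q = inj₂ (trans (sym (⁻¹-involutive p)) (cong -_ (trans (sym ∣p∣≡-p) (trans ∣p∣≡∣q∣ ∣q∣≡q))))
... | inj₂ ∣p∣≡-p | inj₂ ∣q∣≡-q = inj₁ (neg-injective (trans (sym ∣p∣≡-p) (trans ∣p∣≡∣q∣ ∣q∣≡-q)))

^-injective-nonNeg : ∀ {x y} n → 0ℚ ℚ.≤ x → 0ℚ ℚ.≤ y → x ^ suc n ≡ y ^ suc n → x ≡ y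
^-injective-nonNeg {x} {y} n 0≤x 0≤y xⁿ≡yⁿ with <-cmp x y
... | tri< x<y _ _ = contradiction xⁿ≡yⁿ (<⇒≢ (^-monoˡ-< n 0≤x x<y))
... | tri≈ _ x≡y _ = x≡y
... | tri> _ _ y<x = contradiction (sym xⁿ≡yⁿ) (<⇒≢ (^-monoˡ-< n 0≤y y<x))

^-injective-up-to-sign : ∀ x y n → x ^ suc n ≡ y ^ suc n → x ≡ y ⊎ x ≡ - y
^-injective-up-to-sign x y n xⁿ≡yⁿ = ∣p∣≡∣q∣⇒p≡q∨p≡-q x y
  (^-injective-nonNeg n (0≤∣p∣ x) (0≤∣p∣ y) (begin
    ∣ x ∣ ^ suc n ≡⟨ ∣x^n∣≡∣x∣^n x (suc n) ⟨
    ∣ x ^ suc n ∣ ≡⟨ cong ∣_∣ xⁿ≡yⁿ ⟩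
    ∣ y ^ suc n ∣ ≡⟨ ∣x^n∣≡∣x∣^n y (suc n) ⟩
    ∣ y ∣ ^ suc n ∎))

p≡-p⇒p≡0 : ∀ p → p ≡ - p → p ≡ 0ℚ
p≡-p⇒p≡0 p p≡-p = p*q≡0⇒q≡0 (1ℚ + 1ℚ) p (λ ()) (begin
    (1ℚ + 1ℚ) * p ≡⟨ solve 1 (λ p → (con 1ℚ :+ con 1ℚ) :* p := p :+ p) refl p ⟩
    p + p         ≡⟨ cong (p +_) p≡-p ⟩
    p + - p       ≡⟨ +-inverseʳ p ⟩
    0ℚ            ∎)

^-injective-odd : ∀ x y n → ¬ 2 ∣ suc n → x ^ suc n ≡ y ^ suc n → x ≡ y
^-injective-odd x y n 2∤d xⁿ≡yⁿ with ^-injective-up-to-sign x y n xⁿ≡yⁿ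
... | inj₁ x≡y = x≡y
... | inj₂ refl = trans (cong -_ y≡0) (sym y≡0)
  where
  -1^d≡-1 : (- 1ℚ) ^ suc n ≡ - 1ℚ
  -1^d≡-1 = [ (λ (_ , 2∣d) → contradiction 2∣d 2∤d) , proj₁ ]′ (-1^n-parity (suc n))
  yⁿ≡-yⁿ : y ^ suc n ≡ - y ^ suc n
  yⁿ≡-yⁿ = begin
    y ^ suc n                  ≡⟨ xⁿ≡yⁿ ⟨
    (- y) ^ suc n              ≡⟨ cong (_^ suc n) (solve 1 (λ y → :- y := (:- con 1ℚ) :* y) refl y) ⟩
    (- 1ℚ * y) ^ suc n         ≡⟨ ^-distrib-* (- 1ℚ) y (suc n) ⟩
    (- 1ℚ) ^ suc n * y ^ suc n ≡⟨ cong (_* y ^ suc n) -1^d≡-1 ⟩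
    - 1ℚ * y ^ suc n           ≡⟨ solve 1 (λ p → (:- con 1ℚ) :* p := :- p) refl (y ^ suc n) ⟩
    - y ^ suc n                ∎
  y≡0 : y ≡ 0ℚ
  y≡0 = x^n≡0⇒x≡0 y (suc n) (p≡-p⇒p≡0 (y ^ suc n) yⁿ≡-yⁿ)

-- Integers in ℚ and reduced fractions

ι : ℤ → ℚ
ι i = i / 1

toℚᵘ-ι : ∀ i → toℚᵘ (ι i) ℚᵘ.≃ ℚᵘ.mkℚᵘ i 0
toℚᵘ-ι i = toℚᵘ-fromℚᵘ (ℚᵘ.mkℚᵘ i 0)

ι-* : ∀ i j → ι (i ℤ.* j) ≡ ι i * ι j
ι-* i j = toℚᵘ-injective (ℚᵘ.≃-trans (toℚᵘ-ι (i ℤ.* j)) (ℚᵘ.≃-trans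
  (ℚᵘ.*-cong (ℚᵘ.≃-sym (toℚᵘ-ι i)) (ℚᵘ.≃-sym (toℚᵘ-ι j)))
  (ℚᵘ.≃-sym (toℚᵘ-homo-* (ι i) (ι j)))))

ι-+ : ∀ i j → ι (i ℤ.+ j) ≡ ι i + ι j
ι-+ i j = toℚᵘ-injective (ℚᵘ.≃-trans (toℚᵘ-ι (i ℤ.+ j)) (ℚᵘ.≃-trans integral-sum (ℚᵘ.≃-trans
  (ℚᵘ.+-cong (ℚᵘ.≃-sym (toℚᵘ-ι i)) (ℚᵘ.≃-sym (toℚᵘ-ι j)))
  (ℚᵘ.≃-sym (toℚᵘ-homo-+ (ι i) (ι j))))))
  where
  integral-sum : ℚᵘ.mkℚᵘ (i ℤ.+ j) 0 ℚᵘ.≃ ℚᵘ.mkℚᵘ i 0 ℚᵘ.+ ℚᵘ.mkℚᵘ j 0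
  integral-sum = ℚᵘ.*≡* (cong (ℤ._* ℤ.+ 1) (cong₂ ℤ._+_ (sym (ℤ.*-identityʳ i)) (sym (ℤ.*-identityʳ j))))

ι-^ : ∀ i n → ι (i ℤ.^ n) ≡ ι i ^ n
ι-^ i zero = refl
ι-^ i (suc n) = trans (ι-* i (i ℤ.^ n)) (cong (ι i *_) (ι-^ i n))

p*↧p≡↥p : ∀ p → p * ι (↧ p) ≡ ι (↥ p)
p*↧p≡↥p p@(mkℚ n k _) = toℚᵘ-injective (ℚᵘ.≃-trans (toℚᵘ-homo-* p (ι (↧ p))) (ℚᵘ.≃-trans
  (ℚᵘ.*-congˡ {ℚᵘ.mkℚᵘ n k} (toℚᵘ-ι (↧ p)))
  (ℚᵘ.≃-trans cancel-denominator (ℚᵘ.≃-sym (toℚᵘ-ι n)))))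
  where
  cancel-denominator : ℚᵘ.mkℚᵘ n k ℚᵘ.* ℚᵘ.mkℚᵘ (↧ p) 0 ℚᵘ.≃ ℚᵘ.mkℚᵘ n 0
  cancel-denominator = ℚᵘ.*≡* (trans (ℤ.*-identityʳ _) (cong (λ t → n ℤ.* ℤ.+ suc t) (sym (ℕ.*-identityʳ k))))

p*ιj≡ιi⇒↥p*j≡i*↧p : ∀ p i j → p * ι j ≡ ι i → ↥ p ℤ.* j ≡ i ℤ.* ↧ p
p*ιj≡ιi⇒↥p*j≡i*↧p p@(mkℚ n k _) i j pj≡i = trans (sym (ℤ.*-identityʳ _))
  (trans (ℚᵘ.drop-*≡* pj≃i) (cong (λ t → i ℤ.* ℤ.+ suc t) (ℕ.*-identityʳ k)))
  where
  pj≃i : ℚᵘ.mkℚᵘ n k ℚᵘ.* ℚᵘ.mkℚᵘ j 0 ℚᵘ.≃ ℚᵘ.mkℚᵘ i 0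
  pj≃i = ℚᵘ.≃-trans (ℚᵘ.*-congˡ {ℚᵘ.mkℚᵘ n k} (ℚᵘ.≃-sym (toℚᵘ-ι j))) (ℚᵘ.≃-trans
    (ℚᵘ.≃-sym (toℚᵘ-homo-* p (ι j)))
    (ℚᵘ.≃-trans (ℚᵘ.≃-reflexive (cong toℚᵘ pj≡i)) (toℚᵘ-ι i)))

coprime-*ˡ : ∀ {m n o} → Coprime m o → Coprime n o → Coprime (m ℕ.* n) o
coprime-*ˡ {m} m⊥o n⊥o {i} (i∣mn , i∣o) = n⊥o (Coprimality.coprime-divisor i⊥m i∣mn , i∣o)
  where
  i⊥m : Coprime i m
  i⊥m (j∣i , j∣m) = m⊥o (j∣m , ℕ∣.∣-trans j∣i i∣o)

coprime-^ˡ : ∀ {m o} k → Coprime m o → Coprime (m ℕ.^ k) o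
coprime-^ˡ {o = o} zero _ = Coprimality.1-coprimeTo o
coprime-^ˡ (suc k) m⊥o = coprime-*ˡ m⊥o (coprime-^ˡ k m⊥o)

coprime-^ʳ : ∀ {m o} k → Coprime m o → Coprime m (o ℕ.^ k)
coprime-^ʳ k = Coprimality.sym ∘′ coprime-^ˡ k ∘′ Coprimality.sym

reduced-fraction-unique : ∀ {p q r s} → Coprime p q → Coprime r s → s ≢ 0 →
                          p ℕ.* s ≡ r ℕ.* q → p ≡ r × q ≡ s
reduced-fraction-unique {p} {q} {r} {s} p⊥q r⊥s s≢0 ps≡rq = p≡r , q≡s
  where
  q≡s : q ≡ s
  q≡s = ℕ∣.∣-antisym
    (Coprimality.coprime-divisor (Coprimality.sym p⊥q) (subst (q ∣_) (sym ps≡rq) (ℕ∣.n∣m*n r)))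
    (Coprimality.coprime-divisor (Coprimality.sym r⊥s) (subst (s ∣_) ps≡rq (ℕ∣.n∣m*n p)))
  p≡r : p ≡ r
  p≡r = ℕ.*-cancelʳ-≡ p r s {{ℕ.≢-nonZero s≢0}} (trans ps≡rq (cong (r ℕ.*_) q≡s))

↥p⊥↧p : ∀ p → Coprime ℤ.∣ ↥ p ∣ (↧ₙ p)
↥p⊥↧p (mkℚ _ _ c) = Coprimality.recompute c

∣i^n∣≡∣i∣^n : ∀ i n → ℤ.∣ i ℤ.^ n ∣ ≡ ℤ.∣ i ∣ ℕ.^ n
∣i^n∣≡∣i∣^n i zero = refl
∣i^n∣≡∣i∣^n i (suc n) = trans (ℤ.abs-* i (i ℤ.^ n)) (cong (ℤ.∣ i ∣ ℕ.*_) (∣i^n∣≡∣i∣^n i n))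

coprime-translate : ∀ b m n → ℤ.∣ b ∣ ≡ 1 → Coprime ℤ.∣ n ∣ ℤ.∣ m ∣ →
                    Coprime ℤ.∣ n ∣ ℤ.∣ b ℤ.* m ℤ.+ n ∣ × Coprime ℤ.∣ m ∣ ℤ.∣ b ℤ.* m ℤ.+ n ∣
coprime-translate b m n ∣b∣≡1 n⊥m = n⊥c , m⊥c
  where
  ∣bm∣≡∣m∣ : ℤ.∣ b ℤ.* m ∣ ≡ ℤ.∣ m ∣
  ∣bm∣≡∣m∣ = trans (ℤ.abs-* b m) (trans (cong (ℕ._* ℤ.∣ m ∣) ∣b∣≡1) (ℕ.*-identityˡ _))
  n⊥c : Coprime ℤ.∣ n ∣ ℤ.∣ b ℤ.* m ℤ.+ n ∣
  n⊥c {i} (i∣n , i∣c) = n⊥m (i∣n , subst (i ∣_) ∣bm∣≡∣m∣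
    (ℤ∣.∣⇒∣ᵤ {ℤ.+ i} (ℤ∣.∣m+n∣n⇒∣m {ℤ.+ i} {b ℤ.* m} (ℤ∣.∣ᵤ⇒∣ {ℤ.+ i} i∣c) (ℤ∣.∣ᵤ⇒∣ {ℤ.+ i} i∣n))))
  m⊥c : Coprime ℤ.∣ m ∣ ℤ.∣ b ℤ.* m ℤ.+ n ∣
  m⊥c {i} (i∣m , i∣c) = n⊥m (ℤ∣.∣⇒∣ᵤ {ℤ.+ i}
    (ℤ∣.∣m+n∣m⇒∣n {ℤ.+ i} {b ℤ.* m} (ℤ∣.∣ᵤ⇒∣ {ℤ.+ i} i∣c) (ℤ∣.∣n⇒∣m*n b (ℤ∣.∣ᵤ⇒∣ {ℤ.+ i} {m} i∣m))) , i∣m)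

cross-multiplied : ∀ b n u u' → u' * (ι b + u) ^ suc n ≡ u →
                   ↥ u' ℤ.* (b ℤ.* ↧ u ℤ.+ ↥ u) ℤ.^ suc n ≡ (↥ u ℤ.* ↧ u ℤ.^ n) ℤ.* ↧ u'
cross-multiplied b n u u' step = p*ιj≡ιi⇒↥p*j≡i*↧p u' (ν ℤ.* μ ℤ.^ n) (c ℤ.^ suc n) (begin
  u' * ι (c ℤ.^ suc n)                  ≡⟨ cong (u' *_) (ι-^ c (suc n)) ⟩
  u' * ι c ^ suc n                      ≡⟨ cong (λ t → u' * t ^ suc n) [b+u]μ≡c ⟨
  u' * ((ι b + u) * ι μ) ^ suc n        ≡⟨ cong (u' *_) (^-distrib-* (ι b + u) (ι μ) (suc n)) ⟩
  u' * ((ι b + u) ^ suc n * ι μ ^ suc n) ≡⟨ *-assoc u' _ _ ⟨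
  u' * (ι b + u) ^ suc n * ι μ ^ suc n  ≡⟨ cong (_* ι μ ^ suc n) step ⟩
  u * (ι μ * ι μ ^ n)                   ≡⟨ *-assoc u _ _ ⟨
  u * ι μ * ι μ ^ n                     ≡⟨ cong₂ _*_ (p*↧p≡↥p u) (sym (ι-^ μ n)) ⟩
  ι ν * ι (μ ℤ.^ n)                     ≡⟨ ι-* ν (μ ℤ.^ n) ⟨
  ι (ν ℤ.* μ ℤ.^ n)                     ∎)
  where
  ν μ c : ℤ
  ν = ↥ u
  μ = ↧ u
  c = b ℤ.* μ ℤ.+ ν
  [b+u]μ≡c : (ι b + u) * ι μ ≡ ι c
  [b+u]μ≡c = begin
    (ι b + u) * ι μ     ≡⟨ *-distribʳ-+ (ι μ) (ι b) u ⟩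
    ι b * ι μ + u * ι μ ≡⟨ cong₂ _+_ (sym (ι-* b μ)) (p*↧p≡↥p u) ⟩
    ι (b ℤ.* μ) + ι ν   ≡⟨ ι-+ (b ℤ.* μ) ν ⟨
    ι c                 ∎

∣i∣≡1⇒i≡±1 : ∀ i → ℤ.∣ i ∣ ≡ 1 → i ≡ ℤ.1ℤ ⊎ i ≡ ℤ.-1ℤ
∣i∣≡1⇒i≡±1 (ℤ.+ 1) _ = inj₁ refl
∣i∣≡1⇒i≡±1 ℤ.-[1+ 0 ] _ = inj₂ refl

module MultiplierStep (b : ℤ) (∣b∣≡1 : ℤ.∣ b ∣ ≡ 1) (n : ℕ) (u u' : ℚ) (u≢0 : u ≢ 0ℚ)
                      (step : u' * (ι b + u) ^ suc n ≡ u) where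

  ν μ : ℕ
  ν = ℤ.∣ ↥ u ∣
  μ = ↧ₙ u

  instance
    ν≢0 : ℕ.NonZero ν
    ν≢0 = ℕ.≢-nonZero (u≢0 ∘′ ↥p≡0⇒p≡0 u ∘′ ℤ.∣i∣≡0⇒i≡0)
    μⁿ≢0 : ℕ.NonZero (μ ℕ.^ n)
    μⁿ≢0 = ℕ.m^n≢0 μ n

  -- u' = ν μ^(d-1) / (bμ + ν)^d in lowest terms, as gcd(ν, bμ + ν) = gcd(μ, bμ + ν) = gcd(ν, μ) = 1.
  fraction : ℤ.∣ ↥ u' ∣ ≡ ν ℕ.* μ ℕ.^ n × ↧ₙ u' ≡ ℤ.∣ b ℤ.* ↧ u ℤ.+ ↥ u ∣ ℕ.^ suc n
  fraction = reduced-fraction-unique (↥p⊥↧p u') A⊥B B≢0 cross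
    where
    c : ℤ
    c = b ℤ.* ↧ u ℤ.+ ↥ u
    A B : ℕ
    A = ν ℕ.* μ ℕ.^ n
    B = ℤ.∣ c ∣ ℕ.^ suc n
    A⊥B : Coprime A B
    A⊥B with coprime-translate b (↧ u) (↥ u) ∣b∣≡1 (↥p⊥↧p u)
    ... | ν⊥c , μ⊥c = coprime-*ˡ (coprime-^ʳ (suc n) ν⊥c) (coprime-^ˡ n (coprime-^ʳ (suc n) μ⊥c))
    cross : ℤ.∣ ↥ u' ∣ ℕ.* B ≡ A ℕ.* ↧ₙ u'
    cross = begin
      ℤ.∣ ↥ u' ∣ ℕ.* ℤ.∣ c ∣ ℕ.^ suc n         ≡⟨ cong (ℤ.∣ ↥ u' ∣ ℕ.*_) (∣i^n∣≡∣i∣^n c (suc n)) ⟨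
      ℤ.∣ ↥ u' ∣ ℕ.* ℤ.∣ c ℤ.^ suc n ∣         ≡⟨ ℤ.abs-* (↥ u') (c ℤ.^ suc n) ⟨
      ℤ.∣ ↥ u' ℤ.* c ℤ.^ suc n ∣               ≡⟨ cong ℤ.∣_∣ (cross-multiplied b n u u' step) ⟩
      ℤ.∣ (↥ u ℤ.* ↧ u ℤ.^ n) ℤ.* ↧ u' ∣       ≡⟨ ℤ.abs-* (↥ u ℤ.* ↧ u ℤ.^ n) (↧ u') ⟩
      ℤ.∣ ↥ u ℤ.* ↧ u ℤ.^ n ∣ ℕ.* ↧ₙ u'        ≡⟨ cong (ℕ._* ↧ₙ u') (ℤ.abs-* (↥ u) (↧ u ℤ.^ n)) ⟩
      ν ℕ.* ℤ.∣ ↧ u ℤ.^ n ∣ ℕ.* ↧ₙ u'          ≡⟨ cong (λ t → ν ℕ.* t ℕ.* ↧ₙ u') (∣i^n∣≡∣i∣^n (↧ u) n) ⟩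
      A ℕ.* ↧ₙ u'                               ∎
    B≢0 : B ≢ 0
    B≢0 B≡0 = ℕ.≢-nonZero⁻¹ A {{ℕ.m*n≢0 ν (μ ℕ.^ n)}}
      (ℕ.m*n≡0⇒m≡0 A (↧ₙ u') (trans (sym cross) (trans (cong (ℤ.∣ ↥ u' ∣ ℕ.*_) B≡0) (ℕ.*-zeroʳ ℤ.∣ ↥ u' ∣))))

  numerator-nondecreasing : ν ≤ ℤ.∣ ↥ u' ∣
  numerator-nondecreasing = subst (ν ≤_) (sym (proj₁ fraction)) (ℕ.m≤m*n ν (μ ℕ.^ n))

  numerator-stable⇒μⁿ≡1 : ℤ.∣ ↥ u' ∣ ≤ ν → μ ℕ.^ n ≡ 1
  numerator-stable⇒μⁿ≡1 ν'≤ν = ℕ.*-cancelˡ-≡ _ 1 ν (begin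
    ν ℕ.* μ ℕ.^ n ≡⟨ proj₁ fraction ⟨
    ℤ.∣ ↥ u' ∣    ≡⟨ ℕ.≤-antisym ν'≤ν numerator-nondecreasing ⟩
    ν             ≡⟨ ℕ.*-identityʳ ν ⟨
    ν ℕ.* 1       ∎)

  integral⇒unit : ↧ₙ u ≡ 1 → ↧ₙ u' ≡ 1 → ι b + u ≡ 1ℚ ⊎ ι b + u ≡ - 1ℚ
  integral⇒unit μ≡1 μ'≡1 = [ inj₁ ∘′ ι[b+ν]≡ , inj₂ ∘′ ι[b+ν]≡ ]′ (∣i∣≡1⇒i≡±1 (b ℤ.+ ↥ u) ∣b+ν∣≡1)
    where
    ↧u≡1 : ↧ u ≡ ℤ.1ℤ
    ↧u≡1 = cong ℤ.+_ μ≡1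
    ∣b+ν∣≡1 : ℤ.∣ b ℤ.+ ↥ u ∣ ≡ 1
    ∣b+ν∣≡1 = ℕ.m*n≡1⇒m≡1 _ _ (begin
      ℤ.∣ b ℤ.+ ↥ u ∣ ℕ.^ suc n          ≡⟨ cong (λ t → ℤ.∣ t ℤ.+ ↥ u ∣ ℕ.^ suc n) (ℤ.*-identityʳ b) ⟨
      ℤ.∣ b ℤ.* ℤ.1ℤ ℤ.+ ↥ u ∣ ℕ.^ suc n ≡⟨ cong (λ t → ℤ.∣ b ℤ.* t ℤ.+ ↥ u ∣ ℕ.^ suc n) ↧u≡1 ⟨
      ℤ.∣ b ℤ.* ↧ u ℤ.+ ↥ u ∣ ℕ.^ suc n  ≡⟨ proj₂ fraction ⟨
      ↧ₙ u'                              ≡⟨ μ'≡1 ⟩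
      1                                  ∎)
    ι[b+ν]≡ : ∀ {i} → b ℤ.+ ↥ u ≡ i → ι b + u ≡ ι i
    ι[b+ν]≡ refl = begin
      ι b + u           ≡⟨ cong (ι b +_) (*-identityʳ u) ⟨
      ι b + u * 1ℚ      ≡⟨ cong (λ t → ι b + u * ι t) ↧u≡1 ⟨
      ι b + u * ι (↧ u) ≡⟨ cong (ι b +_) (p*↧p≡↥p u) ⟩
      ι b + ι (↥ u)     ≡⟨ ι-+ b (↥ u) ⟨
      ι (b ℤ.+ ↥ u)     ∎

-- Points of P¹(ℚ) and the multiplier a z^d

-- a z^d = u for the affine coordinate z = X / Y of [X , Y]
record Multiplier (d : ℕ) (a u : ℚ) (p : Pt) : Set where
  constructor multiplier
  field equation : a * proj₁ p ^ d ≡ u * proj₂ p ^ d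

-- [X , Y] = [s X' , Y']
infix 4 _≈P[_]_
record _≈P[_]_ (p : Pt) (s : ℚ) (q : Pt) : Set where
  constructor scaled
  field equation : proj₁ p * proj₂ q ≡ s * (proj₁ q * proj₂ p)

≈P[1]⇒≈P : ∀ {p q} → p ≈P[ 1ℚ ] q → p ≈P q
≈P[1]⇒≈P {X , Y} {X' , Y'} (scaled XY'≡1X'Y) = trans XY'≡1X'Y (*-identityˡ (X' * Y))

≈P⇒≈P[1] : ∀ {p q} → p ≈P q → p ≈P[ 1ℚ ] q
≈P⇒≈P[1] {X , Y} {X' , Y'} XY'≡X'Y = scaled (trans XY'≡X'Y (sym (*-identityˡ (X' * Y))))

≈P[]-sym : ∀ {s p q} → s * s ≡ 1ℚ → p ≈P[ s ] q → q ≈P[ s ] p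
≈P[]-sym {s} {X , Y} {X' , Y'} s²≡1 (scaled XY'≡sX'Y) = scaled (begin
  X' * Y             ≡⟨ *-identityˡ (X' * Y) ⟨
  1ℚ * (X' * Y)      ≡⟨ cong (_* (X' * Y)) s²≡1 ⟨
  s * s * (X' * Y)   ≡⟨ *-assoc s s (X' * Y) ⟩
  s * (s * (X' * Y)) ≡⟨ cong (s *_) XY'≡sX'Y ⟨
  s * (X * Y')       ∎)

≈P[]-trans : ∀ {s t p q r} → proj₁ q ≢ 0ℚ → p ≈P[ s ] q → q ≈P[ t ] r → p ≈P[ s * t ] r
≈P[]-trans {s} {t} {X₁ , Y₁} {X₂ , Y₂} {X₃ , Y₃} X₂≢0 (scaled p≈q) (scaled q≈r) = scaled (*-cancelˡ-≢0 X₂ X₂≢0 (begin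
  X₂ * (X₁ * Y₃)           ≡⟨ solve 3 (λ x₁ x₂ y₃ → x₂ :* (x₁ :* y₃) := x₁ :* (x₂ :* y₃)) refl X₁ X₂ Y₃ ⟩
  X₁ * (X₂ * Y₃)           ≡⟨ cong (X₁ *_) q≈r ⟩
  X₁ * (t * (X₃ * Y₂))     ≡⟨ solve 4 (λ x₁ t x₃ y₂ → x₁ :* (t :* (x₃ :* y₂)) := t :* x₃ :* (x₁ :* y₂)) refl X₁ t X₃ Y₂ ⟩
  t * X₃ * (X₁ * Y₂)       ≡⟨ cong (t * X₃ *_) p≈q ⟩
  t * X₃ * (s * (X₂ * Y₁)) ≡⟨ solve 5 (λ s t x₂ x₃ y₁ → t :* x₃ :* (s :* (x₂ :* y₁)) := x₂ :* (s :* t :* (x₃ :* y₁))) refl s t X₂ X₃ Y₁ ⟩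
  X₂ * (s * t * (X₃ * Y₁)) ∎))

≈P-≈P[]-trans : ∀ {s p q r} → proj₁ q ≢ 0ℚ → p ≈P q → q ≈P[ s ] r → p ≈P[ s ] r
≈P-≈P[]-trans {s} {p} {q} {r} X≢0 p≈q q≈r =
  subst (p ≈P[_] r) (*-identityˡ s) (≈P[]-trans X≢0 (≈P⇒≈P[1] {p} {q} p≈q) q≈r)

≈P[-1]-sym : ∀ {p q} → p ≈P[ - 1ℚ ] q → q ≈P[ - 1ℚ ] p
≈P[-1]-sym = ≈P[]-sym refl

≈P[-1]-trans : ∀ {p q r} → proj₁ q ≢ 0ℚ → p ≈P[ - 1ℚ ] q → q ≈P[ - 1ℚ ] r → p ≈P r
≈P[-1]-trans {p} {q} {r} X≢0 p≈-q q≈-r = ≈P[1]⇒≈P {p} {r} (≈P[]-trans X≢0 p≈-q q≈-r)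

X≡0⇒≈P : ∀ p q → proj₁ p ≡ 0ℚ → proj₁ q ≡ 0ℚ → p ≈P q
X≡0⇒≈P (X , Y) (X' , Y') refl refl = trans (*-zeroˡ Y') (sym (*-zeroˡ Y))

same-multiplier⇒^-equal : ∀ {d a u} {p q : Pt} → a ≢ 0ℚ → Multiplier d a u p → Multiplier d a u q →
                          (proj₁ p * proj₂ q) ^ d ≡ (proj₁ q * proj₂ p) ^ d
same-multiplier⇒^-equal {d} {a} {u} {X , Y} {X' , Y'} a≢0 (multiplier mp) (multiplier mq) = begin
  (X * Y') ^ d    ≡⟨ ^-distrib-* X Y' d ⟩
  X ^ d * Y' ^ d  ≡⟨ *-cancelˡ-≢0 a a≢0 (begin
      a * (X ^ d * Y' ^ d)  ≡⟨ *-assoc a _ _ ⟨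
      a * X ^ d * Y' ^ d    ≡⟨ cong (_* Y' ^ d) mp ⟩
      u * Y ^ d * Y' ^ d    ≡⟨ solve 3 (λ u p q → u :* p :* q := u :* q :* p) refl u (Y ^ d) (Y' ^ d) ⟩
      u * Y' ^ d * Y ^ d    ≡⟨ cong (_* Y ^ d) mq ⟨
      a * X' ^ d * Y ^ d    ≡⟨ *-assoc a _ _ ⟩
      a * (X' ^ d * Y ^ d)  ∎) ⟩
  X' ^ d * Y ^ d  ≡⟨ ^-distrib-* X' Y d ⟨
  (X' * Y) ^ d    ∎

same-multiplier⇒≈P⊎≈P[-1] : ∀ {n a u p q} → a ≢ 0ℚ → Multiplier (suc n) a u p → Multiplier (suc n) a u q →
                            p ≈P q ⊎ p ≈P[ - 1ℚ ] q
same-multiplier⇒≈P⊎≈P[-1] {n} {a} {u} {X , Y} {X' , Y'} a≢0 mp mq =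
  [ inj₁ , (λ XY'≡-X'Y → inj₂ (scaled (trans XY'≡-X'Y (solve 1 (λ x → :- x := (:- con 1ℚ) :* x) refl (X' * Y))))) ]′
  (^-injective-up-to-sign (X * Y') (X' * Y) n (same-multiplier⇒^-equal {suc n} {a} {u} {X , Y} {X' , Y'} a≢0 mp mq))

same-multiplier⇒≈P : ∀ {n a u p q} → ¬ 2 ∣ suc n → a ≢ 0ℚ →
                     Multiplier (suc n) a u p → Multiplier (suc n) a u q → p ≈P q
same-multiplier⇒≈P {n} {a} {u} {X , Y} {X' , Y'} 2∤d a≢0 mp mq =
  ^-injective-odd (X * Y') (X' * Y) n 2∤d (same-multiplier⇒^-equal {suc n} {a} {u} {X , Y} {X' , Y'} a≢0 mp mq)

-- Fixed points

fixed⇒multiplier : ∀ n a b {X Y} → ψ (suc n) a b (X , Y) ≈P (X , Y) → X ≢ 0ℚ →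
                   Multiplier (suc n) a (1ℚ - b) (X , Y)
fixed⇒multiplier n a b {X} {Y} fixed X≢0 = multiplier (*-cancelˡ-≢0 X X≢0 (begin
  X * A                             ≡⟨ solve 5 (λ x a b y p → x :* a := x :* (a :+ b :* (y :* p)) :- x :* b :* (y :* p)) refl X A b Y P ⟩
  X * (A + b * (Y * P)) - X * b * (Y * P) ≡⟨ cong (_- X * b * (Y * P)) fixed ⟨
  X * P * Y - X * b * (Y * P)       ≡⟨ solve 4 (λ x b y p → x :* p :* y :- x :* b :* (y :* p) := x :* ((con 1ℚ :- b) :* (y :* p))) refl X b Y P ⟩
  X * ((1ℚ - b) * (Y * P))          ∎))
  where
  A P : ℚ
  A = a * X ^ suc n
  P = Y ^ n

data FixedPointShape (d : ℕ) (a b : ℚ) (z : Pt) : Set where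
  at-zero  : proj₁ z ≡ 0ℚ → FixedPointShape d a b z
  off-zero : proj₁ z ≢ 0ℚ → Multiplier d a (1ℚ - b) z → FixedPointShape d a b z

fixed-point-shape : ∀ n a b {z} → ψ (suc n) a b z ≈P z → FixedPointShape (suc n) a b z
fixed-point-shape n a b {X , Y} fixed = [ at-zero , (λ X≢0 → off-zero X≢0 (fixed⇒multiplier n a b fixed X≢0)) ]′
  (toSum (X ≟ 0ℚ))

fixed≈zeroPt : ∀ n {a} → a ≢ 0ℚ → ∀ z → IsFixed (suc n) a 1ℚ z → z ≈P zeroPt
fixed≈zeroPt n {a} a≢0 z (_ , fixed) = on-shape (fixed-point-shape n a 1ℚ fixed)
  where
  on-shape : FixedPointShape (suc n) a 1ℚ z → z ≈P zeroPt
  on-shape (at-zero X≡0) = X≡0⇒≈P z zeroPt X≡0 refl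
  on-shape (off-zero X≢0 (multiplier aXᵈ≡0*Yᵈ)) = contradiction
    (x^n≡0⇒x≡0 _ (suc n) (p*q≡0⇒q≡0 a _ a≢0 (trans aXᵈ≡0*Yᵈ (*-zeroˡ (proj₂ z ^ suc n))))) X≢0

no-three-same-multiplier : ∀ {n a u x y w} → a ≢ 0ℚ → proj₁ x ≢ 0ℚ →
  Multiplier (suc n) a u x → Multiplier (suc n) a u y → Multiplier (suc n) a u w →
  ¬ x ≈P y → ¬ x ≈P w → ¬ y ≈P w → ⊥
no-three-same-multiplier a≢0 X≢0 mx my mw x≉y x≉w y≉w =
  [ x≉y , (λ x≈-y → [ x≉w , (λ x≈-w → y≉w (≈P[-1]-trans X≢0 (≈P[-1]-sym x≈-y) x≈-w)) ]′
                       (same-multiplier⇒≈P⊎≈P[-1] a≢0 mx mw)) ]′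
  (same-multiplier⇒≈P⊎≈P[-1] a≢0 mx my)

no-three-fixed-points : ∀ {n a b x y w} → ¬ 2 ∣ suc n → a ≢ 0ℚ →
  IsFixed (suc n) a b x → IsFixed (suc n) a b y → IsFixed (suc n) a b w →
  ¬ x ≈P y → ¬ x ≈P w → ¬ y ≈P w → ⊥
no-three-fixed-points {n} {a} {b} {x} {y} {w} 2∤d a≢0 (_ , fx) (_ , fy) (_ , fw) =
  shapes (fixed-point-shape n a b fx) (fixed-point-shape n a b fy) (fixed-point-shape n a b fw)
  where
  Shape : Pt → Set
  Shape = FixedPointShape (suc n) a b
  shapes : Shape x → Shape y → Shape w → ¬ x ≈P y → ¬ x ≈P w → ¬ y ≈P w → ⊥
  shapes (at-zero x₀) (at-zero y₀) _ x≉y _ _ = x≉y (X≡0⇒≈P x y x₀ y₀)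
  shapes (at-zero x₀) _ (at-zero w₀) _ x≉w _ = x≉w (X≡0⇒≈P x w x₀ w₀)
  shapes _ (at-zero y₀) (at-zero w₀) _ _ y≉w = y≉w (X≡0⇒≈P y w y₀ w₀)
  shapes (off-zero _ mx) (off-zero _ my) _ x≉y _ _ = x≉y (same-multiplier⇒≈P 2∤d a≢0 mx my)
  shapes (off-zero _ mx) _ (off-zero _ mw) _ x≉w _ = x≉w (same-multiplier⇒≈P 2∤d a≢0 mx mw)
  shapes _ (off-zero _ my) (off-zero _ mw) _ _ y≉w = y≉w (same-multiplier⇒≈P 2∤d a≢0 my mw)

no-four-fixed-points : ∀ {n a b x y w v} → a ≢ 0ℚ →
  IsFixed (suc n) a b x → IsFixed (suc n) a b y → IsFixed (suc n) a b w → IsFixed (suc n) a b v →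
  ¬ x ≈P y → ¬ x ≈P w → ¬ x ≈P v → ¬ y ≈P w → ¬ y ≈P v → ¬ w ≈P v → ⊥
no-four-fixed-points {n} {a} {b} {x} {y} {w} {v} a≢0 (_ , fx) (_ , fy) (_ , fw) (_ , fv) =
  shapes (fixed-point-shape n a b fx) (fixed-point-shape n a b fy)
         (fixed-point-shape n a b fw) (fixed-point-shape n a b fv)
  where
  Shape : Pt → Set
  Shape = FixedPointShape (suc n) a b
  shapes : Shape x → Shape y → Shape w → Shape v →
           ¬ x ≈P y → ¬ x ≈P w → ¬ x ≈P v → ¬ y ≈P w → ¬ y ≈P v → ¬ w ≈P v → ⊥
  shapes (at-zero x₀) (at-zero y₀) _ _ x≉y _ _ _ _ _ = x≉y (X≡0⇒≈P x y x₀ y₀)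
  shapes (at-zero x₀) _ (at-zero w₀) _ _ x≉w _ _ _ _ = x≉w (X≡0⇒≈P x w x₀ w₀)
  shapes (at-zero x₀) _ _ (at-zero v₀) _ _ x≉v _ _ _ = x≉v (X≡0⇒≈P x v x₀ v₀)
  shapes _ (at-zero y₀) (at-zero w₀) _ _ _ _ y≉w _ _ = y≉w (X≡0⇒≈P y w y₀ w₀)
  shapes _ (at-zero y₀) _ (at-zero v₀) _ _ _ _ y≉v _ = y≉v (X≡0⇒≈P y v y₀ v₀)
  shapes _ _ (at-zero w₀) (at-zero v₀) _ _ _ _ _ w≉v = w≉v (X≡0⇒≈P w v w₀ v₀)
  shapes (off-zero X≢0 mx) (off-zero _ my) (off-zero _ mw) _ x≉y x≉w _ y≉w _ _ =
    no-three-same-multiplier a≢0 X≢0 mx my mw x≉y x≉w y≉w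
  shapes (off-zero X≢0 mx) (off-zero _ my) _ (off-zero _ mv) x≉y _ x≉v _ y≉v _ =
    no-three-same-multiplier a≢0 X≢0 mx my mv x≉y x≉v y≉v
  shapes (off-zero X≢0 mx) _ (off-zero _ mw) (off-zero _ mv) _ x≉w x≉v _ _ w≉v =
    no-three-same-multiplier a≢0 X≢0 mx mw mv x≉w x≉v w≉v
  shapes _ (off-zero X≢0 my) (off-zero _ mw) (off-zero _ mv) _ _ _ y≉w y≉v w≉v =
    no-three-same-multiplier a≢0 X≢0 my mw mv y≉w y≉v w≉v

module _ {A : Set} {P : A → Set} {R : A → A → Set} where

  no-triple⇒length≤2 : (∀ {x y w} → P x → P y → P w → R x y → R x w → R y w → ⊥) →
                       ∀ xs → All P xs → AllPairs R xs → length xs ≤ 2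
  no-triple⇒length≤2 _ [] _ _ = z≤n
  no-triple⇒length≤2 _ (_ ∷ []) _ _ = s≤s z≤n
  no-triple⇒length≤2 _ (_ ∷ _ ∷ []) _ _ = s≤s (s≤s z≤n)
  no-triple⇒length≤2 no-triple (_ ∷ _ ∷ _ ∷ _) (px ∷ py ∷ pw ∷ _) ((rxy ∷ rxw ∷ _) ∷ (ryw ∷ _) ∷ _) =
    ⊥-elim (no-triple px py pw rxy rxw ryw)

  no-quadruple⇒length≤3 : (∀ {x y w v} → P x → P y → P w → P v →
                             R x y → R x w → R x v → R y w → R y v → R w v → ⊥) →
                          ∀ xs → All P xs → AllPairs R xs → length xs ≤ 3
  no-quadruple⇒length≤3 _ [] _ _ = z≤n
  no-quadruple⇒length≤3 _ (_ ∷ []) _ _ = s≤s z≤n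
  no-quadruple⇒length≤3 _ (_ ∷ _ ∷ []) _ _ = s≤s (s≤s z≤n)
  no-quadruple⇒length≤3 _ (_ ∷ _ ∷ _ ∷ []) _ _ = s≤s (s≤s (s≤s z≤n))
  no-quadruple⇒length≤3 no-quadruple (_ ∷ _ ∷ _ ∷ _ ∷ _) (px ∷ py ∷ pw ∷ pv ∷ _)
    ((rxy ∷ rxw ∷ rxv ∷ _) ∷ (ryw ∷ ryv ∷ _) ∷ (rwv ∷ _) ∷ _) =
    ⊥-elim (no-quadruple px py pw pv rxy rxw rxv ryw ryv rwv)

-- Rational cycles

ψ-zero↦zero : ∀ n {a β X Y X' Y'} → β ≢ 0ℚ → Y ≢ 0ℚ → X ≡ 0ℚ →
              ψ (suc n) a β (X , Y) ≈P (X' , Y') → X' ≡ 0ℚ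
ψ-zero↦zero n {a} {β} {Y = Y} {X'} {Y'} β≢0 Y≢0 refl ψz≈z' =
  p*q≡0⇒q≡0 (β * Y ^ suc n) X' (*-≢0 β≢0 (^-≢0 (suc n) Y≢0)) (begin
    β * Y ^ suc n * X'                        ≡⟨ *-comm _ X' ⟩
    X' * (β * Y ^ suc n)                      ≡⟨ cong (X' *_) (+-identityˡ (β * Y ^ suc n)) ⟨
    X' * (0ℚ + β * Y ^ suc n)                 ≡⟨ cong (λ t → X' * (t + β * Y ^ suc n)) a0ᵈ≡0 ⟨
    X' * (a * 0ℚ ^ suc n + β * Y ^ suc n)     ≡⟨ ψz≈z' ⟨
    0ℚ * Y ^ n * Y'                           ≡⟨ cong (_* Y') (*-zeroˡ (Y ^ n)) ⟩
    0ℚ * Y'                                   ≡⟨ *-zeroˡ Y' ⟩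
    0ℚ                                        ∎)
  where
  a0ᵈ≡0 : a * 0ℚ ^ suc n ≡ 0ℚ
  a0ᵈ≡0 = trans (cong (a *_) (*-zeroˡ (0ℚ ^ n))) (*-zeroʳ a)

ψ-∞↦zero : ∀ k {a β X Y X' Y'} → a ≢ 0ℚ → X ≢ 0ℚ → Y ≡ 0ℚ →
           ψ (suc (suc k)) a β (X , Y) ≈P (X' , Y') → X' ≡ 0ℚ
ψ-∞↦zero k {a} {β} {X} {X' = X'} {Y'} a≢0 X≢0 refl ψ∞≈z' =
  p*q≡0⇒q≡0 (a * X ^ d) X' (*-≢0 a≢0 (^-≢0 d X≢0)) (begin
    a * X ^ d * X'                ≡⟨ *-comm _ X' ⟩
    X' * (a * X ^ d)              ≡⟨ cong (λ t → X' * t) (+-identityʳ (a * X ^ d)) ⟨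
    X' * (a * X ^ d + 0ℚ)         ≡⟨ cong (λ t → X' * (a * X ^ d + t)) β0ᵈ≡0 ⟨
    X' * (a * X ^ d + β * 0ℚ ^ d) ≡⟨ ψ∞≈z' ⟨
    X * 0ℚ ^ suc k * Y'           ≡⟨ cong (λ t → X * t * Y') (*-zeroˡ (0ℚ ^ k)) ⟩
    X * 0ℚ * Y'                   ≡⟨ cong (_* Y') (*-zeroʳ X) ⟩
    0ℚ * Y'                       ≡⟨ *-zeroˡ Y' ⟩
    0ℚ                            ∎)
  where
  d : ℕ
  d = suc (suc k)
  β0ᵈ≡0 : β * 0ℚ ^ d ≡ 0ℚ
  β0ᵈ≡0 = trans (cong (β *_) (*-zeroˡ (0ℚ ^ suc k))) (*-zeroʳ β)

ψ-step : ∀ n {a β u X Y X' Y'} → Y ≢ 0ℚ → Multiplier (suc n) a u (X , Y) →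
         ψ (suc n) a β (X , Y) ≈P (X' , Y') → (X , Y) ≈P[ β + u ] (X' , Y')
ψ-step n {a} {β} {u} {X} {Y} {X'} {Y'} Y≢0 (multiplier aXᵈ≡uYᵈ) ψz≈z' =
  scaled (*-cancelˡ-≢0 (Y ^ n) (^-≢0 n Y≢0) (begin
    Y ^ n * (X * Y')                          ≡⟨ solve 3 (λ p x y' → p :* (x :* y') := x :* p :* y') refl (Y ^ n) X Y' ⟩
    X * Y ^ n * Y'                            ≡⟨ ψz≈z' ⟩
    X' * (a * X ^ suc n + β * Y ^ suc n)      ≡⟨ cong (λ t → X' * (t + β * Y ^ suc n)) aXᵈ≡uYᵈ ⟩
    X' * (u * (Y * Y ^ n) + β * (Y * Y ^ n))  ≡⟨ solve 5 (λ x' u β y p → x' :* (u :* (y :* p) :+ β :* (y :* p)) := p :* ((β :+ u) :* (x' :* y))) refl X' u β Y (Y ^ n) ⟩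
    Y ^ n * ((β + u) * (X' * Y))              ∎))

scaled-multiplier : ∀ d {a s u u' X Y X' Y'} → Y ≢ 0ℚ → Y' ≢ 0ℚ →
                    Multiplier d a u (X , Y) → Multiplier d a u' (X' , Y') →
                    (X , Y) ≈P[ s ] (X' , Y') → u' * s ^ d ≡ u
scaled-multiplier d {a} {s} {u} {u'} {X} {Y} {X'} {Y'} Y≢0 Y'≢0
  (multiplier aXᵈ≡uYᵈ) (multiplier aX'ᵈ≡u'Y'ᵈ) (scaled XY'≡sX'Y) =
  *-cancelʳ-≢0 (Y ^ d * Y' ^ d) (*-≢0 (^-≢0 d Y≢0) (^-≢0 d Y'≢0)) (begin
    u' * s ^ d * (Y ^ d * Y' ^ d)  ≡⟨ solve 4 (λ u' t p q → u' :* t :* (p :* q) := t :* p :* (u' :* q)) refl u' (s ^ d) (Y ^ d) (Y' ^ d) ⟩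
    s ^ d * Y ^ d * (u' * Y' ^ d)  ≡⟨ cong (s ^ d * Y ^ d *_) aX'ᵈ≡u'Y'ᵈ ⟨
    s ^ d * Y ^ d * (a * X' ^ d)   ≡⟨ solve 4 (λ t p a q → t :* p :* (a :* q) := a :* (t :* (q :* p))) refl (s ^ d) (Y ^ d) a (X' ^ d) ⟩
    a * (s ^ d * (X' ^ d * Y ^ d)) ≡⟨ cong (λ t → a * (s ^ d * t)) (^-distrib-* X' Y d) ⟨
    a * (s ^ d * (X' * Y) ^ d)     ≡⟨ cong (a *_) (^-distrib-* s (X' * Y) d) ⟨
    a * (s * (X' * Y)) ^ d         ≡⟨ cong (λ t → a * t ^ d) XY'≡sX'Y ⟨
    a * (X * Y') ^ d               ≡⟨ cong (a *_) (^-distrib-* X Y' d) ⟩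
    a * (X ^ d * Y' ^ d)           ≡⟨ *-assoc a _ _ ⟨
    a * X ^ d * Y' ^ d             ≡⟨ cong (_* Y' ^ d) aXᵈ≡uYᵈ ⟩
    u * Y ^ d * Y' ^ d             ≡⟨ *-assoc u _ _ ⟩
    u * (Y ^ d * Y' ^ d)           ∎)

inject₁⊎fromℕ : ∀ {m} (i : Fin (suc m)) → (∃[ j ] inject₁ j ≡ i) ⊎ fromℕ m ≡ i
inject₁⊎fromℕ {zero} zero = inj₂ refl
inject₁⊎fromℕ {suc m} zero = inj₁ (zero , refl)
inject₁⊎fromℕ {suc m} (suc i) =
  [ (λ { (j , refl) → inj₁ (suc j , refl) }) , (λ { refl → inj₂ refl }) ]′ (inject₁⊎fromℕ i)

inject₁≢suc : ∀ {m} (i : Fin m) → inject₁ i ≢ suc i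
inject₁≢suc i i≡1+i = ℕ.1+n≢n (trans (sym (cong toℕ i≡1+i)) (toℕ-inject₁ i))

cyclically-nondecreasing⇒constant : ∀ {m} (g : Fin (suc m) → ℕ) →
  (∀ i → g (inject₁ i) ≤ g (suc i)) → g (fromℕ m) ≤ g zero → ∀ i → g i ≡ g zero
cyclically-nondecreasing⇒constant {m} g step wrap i =
  ℕ.≤-antisym (ℕ.≤-trans (below-last i) wrap) (above-zero i)
  where
  above-zero : ∀ i → g zero ≤ g i
  above-zero = <-weakInduction (λ i → g zero ≤ g i) ℕ.≤-refl (λ i h → ℕ.≤-trans h (step i))
  below-last : ∀ i → g i ≤ g (fromℕ m)
  below-last = >-weakInduction (λ i → g i ≤ g (fromℕ m)) ℕ.≤-refl (λ i h → ℕ.≤-trans (step i) h)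

module RationalCycle {k : ℕ} {a : ℚ} (a≢0 : a ≢ 0ℚ) {b : ℤ} (∣b∣≡1 : ℤ.∣ b ∣ ≡ 1)
                     {m : ℕ} {z : Fin (suc (suc m)) → Pt}
                     (cycle : IsCycle (suc (suc k)) a (ι b) (suc m) z) where

  open IsCycle cycle

  d : ℕ
  d = suc (suc k)

  β : ℚ
  β = ι b

  X Y : Fin (suc (suc m)) → ℚ
  X i = proj₁ (z i)
  Y i = proj₂ (z i)

  β≢0 : β ≢ 0ℚ
  β≢0 = [ (λ { refl → λ () }) , (λ { refl → λ () }) ]′ (∣i∣≡1⇒i≡±1 b ∣b∣≡1)

  successor : ∀ i → ∃[ j ] i ≢ j × ψ d a β (z i) ≈P z j
  successor i = [ (λ { (j , refl) → suc j , inject₁≢suc j , step j }) , (λ { refl → zero , (λ ()) , wrap }) ]′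
    (inject₁⊎fromℕ i)

  X≢0 : ∀ i → X i ≢ 0ℚ
  X≢0 i Xi≡0 with successor i
  ... | j , i≢j , zi↦zj = i≢j (distinct i j (X≡0⇒≈P (z i) (z j) Xi≡0
        (ψ-zero↦zero (suc k) {a} {β} β≢0 (λ Yi≡0 → valid i (Xi≡0 , Yi≡0)) Xi≡0 zi↦zj)))

  Y≢0 : ∀ i → Y i ≢ 0ℚ
  Y≢0 i Yi≡0 with successor i
  ... | j , _ , zi↦zj = X≢0 j (ψ-∞↦zero k {a} {β} a≢0 (X≢0 i) Yi≡0 zi↦zj)

  instance
    Yᵈ≢0 : ∀ {i} → NonZero (Y i ^ d)
    Yᵈ≢0 {i} = ≢-nonZero (^-≢0 d (Y≢0 i))

  u : Fin (suc (suc m)) → ℚ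
  u i = a * X i ^ d ÷ Y i ^ d

  multiplier-u : ∀ i → Multiplier d a (u i) (z i)
  multiplier-u i = multiplier (begin
    a * X i ^ d                        ≡⟨ *-identityʳ _ ⟨
    a * X i ^ d * 1ℚ                   ≡⟨ cong (a * X i ^ d *_) (*-inverseˡ (Y i ^ d)) ⟨
    a * X i ^ d * (1/ Y i ^ d * Y i ^ d) ≡⟨ *-assoc (a * X i ^ d) _ _ ⟨
    u i * Y i ^ d                      ∎)

  u≢0 : ∀ i → u i ≢ 0ℚ
  u≢0 i ui≡0 = *-≢0 a≢0 (^-≢0 d (X≢0 i))
    (trans (Multiplier.equation (multiplier-u i)) (trans (cong (_* Y i ^ d) ui≡0) (*-zeroˡ (Y i ^ d))))

  step-multiplier : ∀ {i j} → ψ d a β (z i) ≈P z j → u j * (β + u i) ^ d ≡ u i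
  step-multiplier {i} {j} zi↦zj =
    scaled-multiplier d (Y≢0 i) (Y≢0 j) (multiplier-u i) (multiplier-u j) (ψ-step (suc k) {a} {β} (Y≢0 i) (multiplier-u i) zi↦zj)

  numerator : Fin (suc (suc m)) → ℕ
  numerator i = ℤ.∣ ↥ u i ∣

  numerator-step : ∀ {i j} → ψ d a β (z i) ≈P z j → numerator i ≤ numerator j
  numerator-step {i} {j} zi↦zj =
    MultiplierStep.numerator-nondecreasing b ∣b∣≡1 (suc k) (u i) (u j) (u≢0 i) (step-multiplier zi↦zj)

  numerator-constant : ∀ i → numerator i ≡ numerator zero
  numerator-constant = cyclically-nondecreasing⇒constant numerator (λ i → numerator-step (step i)) (numerator-step wrap)

  integral : ∀ i → ↧ₙ u i ≡ 1
  integral i with successor i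
  ... | j , _ , zi↦zj = ℕ.m*n≡1⇒m≡1 _ _ (MultiplierStep.numerator-stable⇒μⁿ≡1 b ∣b∣≡1 (suc k) (u i) (u j) (u≢0 i)
        (step-multiplier zi↦zj) (ℕ.≤-reflexive (trans (numerator-constant j) (sym (numerator-constant i)))))

  -- All multipliers on the cycle are integers, so b + u = ±1; the sign +1 would make z i a fixed point.
  antipodal : ∀ {i j} → i ≢ j → ψ d a β (z i) ≈P z j → β + u i ≡ - 1ℚ × z i ≈P[ - 1ℚ ] z j
  antipodal {i} {j} i≢j zi↦zj =
    [ (λ β+u≡1 → contradiction (distinct i j (≈P[1]⇒≈P (subst (z i ≈P[_] z j) β+u≡1 zi≈zj))) i≢j)
    , (λ β+u≡-1 → β+u≡-1 , subst (z i ≈P[_] z j) β+u≡-1 zi≈zj) ]′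
    (MultiplierStep.integral⇒unit b ∣b∣≡1 (suc k) (u i) (u j) (u≢0 i) (step-multiplier zi↦zj) (integral i) (integral j))
    where
    zi≈zj : z i ≈P[ β + u i ] z j
    zi≈zj = ψ-step (suc k) {a} {β} (Y≢0 i) (multiplier-u i) zi↦zj

cycle-length≤2 : ∀ {k a} → a ≢ 0ℚ → ∀ m z → IsCycle (suc (suc k)) a 1ℚ m z → suc m ≡ 1 ⊎ suc m ≡ 2
cycle-length≤2 a≢0 zero _ _ = inj₁ refl
cycle-length≤2 a≢0 (suc zero) _ _ = inj₂ refl
cycle-length≤2 a≢0 (suc (suc m)) z cycle = contradiction (distinct zero (suc (suc zero)) z₀≈z₂) λ ()
  where
  open IsCycle cycle
  open RationalCycle a≢0 {b = ℤ.1ℤ} refl cycle using (X≢0; antipodal)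
  z₀≈z₂ : z zero ≈P z (suc (suc zero))
  z₀≈z₂ = ≈P[-1]-trans (X≢0 (suc zero))
    (proj₂ (antipodal (λ ()) (step zero))) (proj₂ (antipodal (λ ()) (step (suc zero))))

two-cycle⇒2∣d : ∀ {k a} → a ≢ 0ℚ → ∀ z → IsCycle (suc (suc k)) a 1ℚ 1 z → 2 ∣ suc (suc k)
two-cycle⇒2∣d {k} a≢0 z cycle =
  [ proj₂ , (λ (-1ᵈ≡-1 , _) → contradiction (trans (sym -1ᵈ≡-1) -1ᵈ≡1) λ ()) ]′ (-1^n-parity (suc (suc k)))
  where
  open IsCycle cycle
  open RationalCycle a≢0 {b = ℤ.1ℤ} refl cycle using (u; u≢0; antipodal; step-multiplier)
  1+u₀≡-1 : 1ℚ + u zero ≡ - 1ℚ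
  1+u₀≡-1 = proj₁ (antipodal (λ ()) (step zero))
  u₀≡u₁ : u zero ≡ u (suc zero)
  u₀≡u₁ = ∙-cancelˡ 1ℚ _ _ (trans 1+u₀≡-1 (sym (proj₁ (antipodal (λ ()) wrap))))
  -1ᵈ≡1 : (- 1ℚ) ^ suc (suc k) ≡ 1ℚ
  -1ᵈ≡1 = *-cancelˡ-≢0 (u (suc zero)) (u≢0 (suc zero)) (begin
    u (suc zero) * (- 1ℚ) ^ suc (suc k)       ≡⟨ cong (λ t → u (suc zero) * t ^ suc (suc k)) 1+u₀≡-1 ⟨
    u (suc zero) * (1ℚ + u zero) ^ suc (suc k) ≡⟨ step-multiplier (step zero) ⟩
    u zero                                    ≡⟨ u₀≡u₁ ⟩
    u (suc zero)                              ≡⟨ *-identityʳ (u (suc zero)) ⟨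
    u (suc zero) * 1ℚ                         ∎)

two-cycle-unique : ∀ {k a} → a ≢ 0ℚ → ∀ z w → IsCycle (suc (suc k)) a 1ℚ 1 z → IsCycle (suc (suc k)) a 1ℚ 1 w →
  (z zero ≈P w zero × z (suc zero) ≈P w (suc zero)) ⊎ (z zero ≈P w (suc zero) × z (suc zero) ≈P w zero)
two-cycle-unique {k} {a} a≢0 z w z-cycle w-cycle =
  [ (λ z₀≈w₀ → inj₁ (z₀≈w₀ , aligned z₀≈w₀)) , (λ z₀≈-w₀ → inj₂ (swapped z₀≈-w₀)) ]′
  (same-multiplier⇒≈P⊎≈P[-1] a≢0 (Z.multiplier-u zero) w₀-multiplier)
  where
  module Z = RationalCycle a≢0 {b = ℤ.1ℤ} refl z-cycle
  module W = RationalCycle a≢0 {b = ℤ.1ℤ} refl w-cycle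
  z-antipodal : Z.β + Z.u zero ≡ - 1ℚ × z zero ≈P[ - 1ℚ ] z (suc zero)
  z-antipodal = Z.antipodal (λ ()) (IsCycle.step z-cycle zero)
  w-antipodal : W.β + W.u zero ≡ - 1ℚ × w zero ≈P[ - 1ℚ ] w (suc zero)
  w-antipodal = W.antipodal (λ ()) (IsCycle.step w-cycle zero)
  z₀≈-z₁ : z zero ≈P[ - 1ℚ ] z (suc zero)
  z₀≈-z₁ = proj₂ z-antipodal
  w₀≈-w₁ : w zero ≈P[ - 1ℚ ] w (suc zero)
  w₀≈-w₁ = proj₂ w-antipodal
  w₀-multiplier : Multiplier (suc (suc k)) a (Z.u zero) (w zero)
  w₀-multiplier = subst (λ t → Multiplier (suc (suc k)) a t (w zero))
    (∙-cancelˡ 1ℚ (W.u zero) (Z.u zero) (trans (proj₁ w-antipodal) (sym (proj₁ z-antipodal)))) (W.multiplier-u zero)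
  aligned : z zero ≈P w zero → z (suc zero) ≈P w (suc zero)
  aligned z₀≈w₀ = ≈P[-1]-trans (Z.X≢0 zero) (≈P[-1]-sym z₀≈-z₁) (≈P-≈P[]-trans {p = z zero} {w zero} (W.X≢0 zero) z₀≈w₀ w₀≈-w₁)
  swapped : z zero ≈P[ - 1ℚ ] w zero → z zero ≈P w (suc zero) × z (suc zero) ≈P w zero
  swapped z₀≈-w₀ = ≈P[-1]-trans (W.X≢0 zero) z₀≈-w₀ w₀≈-w₁ , ≈P[-1]-trans (Z.X≢0 zero) (≈P[-1]-sym z₀≈-z₁) z₀≈-w₀

no-cycle[-1] : ∀ {k a} → a ≢ 0ℚ → ∀ m z → 2 ≤ suc m → ¬ IsCycle (suc (suc k)) a (- 1ℚ) m z
no-cycle[-1] a≢0 zero z (s≤s ()) _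
no-cycle[-1] a≢0 (suc m) z _ cycle = u≢0 zero (∙-cancelˡ (- 1ℚ) _ _ (trans -1+u₀≡-1 (sym (+-identityʳ (- 1ℚ)))))
  where
  open RationalCycle a≢0 {b = ℤ.-1ℤ} refl cycle using (u; u≢0; antipodal)
  -1+u₀≡-1 : - 1ℚ + u zero ≡ - 1ℚ
  -1+u₀≡-1 = proj₁ (antipodal (λ ()) (IsCycle.step cycle zero))

theorem2p3 : (d : ℕ) → 2 ≤ d → (a : ℚ) → a ≢ 0ℚ →
    ((z : Pt) → IsFixed d a 1ℚ z → z ≈P zeroPt)
    × ((zs : List Pt) → All (IsFixed d a (- 1ℚ)) zs → AllPairs (λ z w → ¬ (z ≈P w)) zs →
         (¬ (2 ∣ d) → length zs ≤ 2) × (2 ∣ d → length zs ≤ 3))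
    × ((m : ℕ) (z : Fin (suc m) → Pt) → IsCycle d a 1ℚ m z → suc m ≡ 1 ⊎ suc m ≡ 2)
    × ((z : Fin 2 → Pt) → IsCycle d a 1ℚ 1 z → 2 ∣ d)
    × ((z w : Fin 2 → Pt) → IsCycle d a 1ℚ 1 z → IsCycle d a 1ℚ 1 w →
         (z zero ≈P w zero × z (suc zero) ≈P w (suc zero))
         ⊎ (z zero ≈P w (suc zero) × z (suc zero) ≈P w zero))
    × ((m : ℕ) (z : Fin (suc m) → Pt) → 2 ≤ suc m → ¬ IsCycle d a (- 1ℚ) m z)
theorem2p3 (suc (suc k)) (s≤s (s≤s z≤n)) a a≢0 =
    fixed≈zeroPt (suc k) a≢0
  , (λ zs fixed distinct →
        (λ 2∤d → no-triple⇒length≤2 (no-three-fixed-points {n = suc k} {b = - 1ℚ} 2∤d a≢0) zs fixed distinct)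
      , (λ _ → no-quadruple⇒length≤3 (no-four-fixed-points {n = suc k} {b = - 1ℚ} a≢0) zs fixed distinct))
  , cycle-length≤2 a≢0
  , two-cycle⇒2∣d a≢0
  , two-cycle-unique a≢0
  , no-cycle[-1] a≢0
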